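{- Let $R=\mathbb{Z}\times\mathbb{Z}$ with coordinatewise addition and multiplication $(a,b)\cdot(c,d)=(ac,ad+bc)$, and consider the template $(A,C,U)$ with $A=\mathbb{Z}^+\times\mathbb{N}$ and $C=U=\mathbb{N}^2$. For $n\ge2$, let $(\alpha_1,\dots,\alpha_n)$ be a list of pairs $\alpha_i=(a_i,b_i)\in\mathbb{Z}^+\times\mathbb{N}$ ($i=1,\dots,n$) with $\gcd(a_1,\dots,a_n)=1$. Then $\mathrm{Frob}(\alpha_1,\dots,\alpha_n)$ is nonempty if and only if $b_i=0$ for at least one $i$.
   Context: $\mathbb{N}$ is the set of nonnegative integers and $\mathbb{Z}^+=\mathbb{N}\setminus\{0\}$. $MN(\alpha_1,\dots,\alpha_n)=\{\sum_{i=1}^n\lambda_i\alpha_i:\lambda_i\in C\}$ (products in $R$), and $\mathrm{Frob}(\alpha_1,\dots,\alpha_n)=\{w\in R:w+\mathbb{N}^2\subseteq MN(\alpha_1,\dots,\alpha_n)\}$. -}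

module Defs where

open import Data.Nat as ℕ using (ℕ; suc)
open import Data.Nat.GCD using (gcd)
open import Data.Integer as ℤ using (ℤ; +_)
open import Data.Product using (_×_; _,_; Σ; ∃)
open import Data.Fin using (Fin) renaming (zero to fz; suc to fs)
open import Relation.Binary.PropositionalEquality using (_≡_)

R : Set
R = ℤ × ℤ

_+R_ : R → R → R
(a , b) +R (c , d) = (a ℤ.+ c , b ℤ.+ d)

_*R_ : R → R → R
(a , b) *R (c , d) = (a ℤ.* c , (a ℤ.* d) ℤ.+ (b ℤ.* c))

0R : R
0R = (+ 0 , + 0)

ι : ℕ × ℕ → R
ι (x , y) = (+ x , + y)

ΣR : ∀ {n} → (Fin n → R) → R
ΣR {ℕ.zero} f = 0R
ΣR {suc n} f = f fz +R ΣR (λ i → f (fs i))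

_∈MN_ : ∀ {n} → R → (Fin n → R) → Set
w ∈MN α = Σ (Fin _ → ℕ × ℕ) λ lam → ΣR (λ i → ι (lam i) *R α i) ≡ w

_∈Frob_ : ∀ {n} → R → (Fin n → R) → Set
w ∈Frob α = ∀ (u : ℕ × ℕ) → (w +R ι u) ∈MN α

gcdFin : ∀ {n} → (Fin n → ℕ) → ℕ
gcdFin {ℕ.zero} f = 0
gcdFin {suc n} f = gcd (f fz) (gcdFin (λ i → f (fs i)))

-- With λᵢ = (xᵢ , yᵢ) the combination Σ λᵢ αᵢ is (x·a , x·b + y·a).
-- If every bᵢ > 0 then x·a ≤ (Σ a) * x·b, so the first coordinate of an
-- element of MN is bounded in terms of its second, and shifting w far
-- enough along the first axis leaves MN.  If b_k = 0, Bézout gives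
-- p·a = 1 + q·a; writing u = r + t a_k with r < a_k, the vector
-- x = r p + (a_k ∸ r) q + t δ_k has x·a = a_k (q·a) + u while
-- x·b ≤ a_k (p·b + q·b) does not depend on t, and the y-part fills up
-- the second coordinate.
module Submission where

open import Defs
open import Data.Nat using (ℕ; _≥_; _>_)
open import Data.Fin using (Fin)
open import Data.Product using (_×_; _,_; ∃)
open import Data.Integer using (+_)
open import Relation.Binary.PropositionalEquality using (_≡_)
open import Function.Bundles using (_⇔_)

open import Data.Nat using (zero; suc; _+_; _*_; _∸_; _≤_; _≟_; NonZero; >-nonZero)
open import Data.Nat.Properties
open import Data.Nat.DivMod using (_%_; _/_; m≡m%n+[m/n]*n; m%n≤n)
open import Data.Nat.GCD using (gcd; gcd-GCD; module Bézout)
open import Data.Nat.Tactic.RingSolver using (solve-∀)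
import Data.Integer as ℤ
import Data.Integer.Properties as ℤ
open import Data.Fin using () renaming (zero to fz; suc to fs)
open import Data.Fin.Properties using (any?)
open import Data.Product using (∃₂; proj₁; proj₂)
open import Data.Vec.Functional using (_∷_)
open import Function.Bundles using (mk⇔)
open import Relation.Binary.PropositionalEquality
  using (refl; sym; trans; cong; cong₂; module ≡-Reasoning)
open import Relation.Nullary using (¬_; yes; no; contradiction)
open import Algebra.Properties.CommutativeSemigroup +-commutativeSemigroup
  using () renaming (interchange to +-interchange)
open import Algebra.Properties.CommutativeSemigroup *-commutativeSemigroup
  using () renaming (x∙yz≈y∙xz to *-left-commute)
open import Algebra.Properties.Semiring.Sum +-*-semiring
  using (sum; sum-cong-≗; sum-replicate-zero; ∑-distrib-+; *-distribˡ-sum)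

infix 9 _·_

_·_ : ∀ {n} → (Fin n → ℕ) → (Fin n → ℕ) → ℕ
x · a = sum (λ i → x i * a i)

δ : ∀ {n} → Fin n → Fin n → ℕ
δ fz     fz     = 1
δ fz     (fs _) = 0
δ (fs _) fz     = 0
δ (fs k) (fs i) = δ k i

pairs : ∀ {n} → (Fin n → ℕ) → (Fin n → ℕ) → Fin n → R
pairs a b i = (+ a i , + b i)

sum-scale : ∀ {n} c (f : Fin n → ℕ) → sum (λ i → c * f i) ≡ c * sum f
sum-scale c f = sym (*-distribˡ-sum c f)

≤-sum : ∀ {n} (f : Fin n → ℕ) i → f i ≤ sum f
≤-sum f fz     = m≤m+n _ _
≤-sum f (fs i) = ≤-trans (≤-sum (λ j → f (fs j)) i) (m≤n+m _ (f fz))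

·-distribˡ-+ : ∀ {n} (x y a : Fin n → ℕ) → (λ i → x i + y i) · a ≡ x · a + y · a
·-distribˡ-+ x y a =
  trans (sum-cong-≗ (λ i → *-distribʳ-+ (a i) (x i) (y i)))
        (∑-distrib-+ (λ i → x i * a i) (λ i → y i * a i))

·-scaleˡ : ∀ {n} c (x a : Fin n → ℕ) → (λ i → c * x i) · a ≡ c * x · a
·-scaleˡ c x a = trans (sum-cong-≗ (λ i → *-assoc c (x i) (a i))) (sum-scale c (λ i → x i * a i))

·-scaleʳ : ∀ {n} c (x a : Fin n → ℕ) → x · (λ i → c * a i) ≡ c * x · a
·-scaleʳ c x a = trans (sum-cong-≗ (λ i → *-left-commute (x i) c (a i))) (sum-scale c (λ i → x i * a i))

δ-· : ∀ {n} (k : Fin n) (a : Fin n → ℕ) → δ k · a ≡ a k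
δ-· {suc n} fz a = trans (cong₂ _+_ (*-identityˡ (a fz)) (sum-replicate-zero n)) (+-identityʳ (a fz))
δ-· (fs k) a = δ-· k (λ i → a (fs i))

·-monoʳ-≤ : ∀ {n} (x : Fin n → ℕ) {a b : Fin n → ℕ} → (∀ i → a i ≤ b i) → x · a ≤ x · b
·-monoʳ-≤ {zero}  x a≤b = ≤-refl
·-monoʳ-≤ {suc n} x a≤b =
  +-mono-≤ (*-monoʳ-≤ (x fz) (a≤b fz)) (·-monoʳ-≤ (λ i → x (fs i)) (λ i → a≤b (fs i)))

ι*pair : ∀ x y a b → ι (x , y) *R (+ a , + b) ≡ (+ (x * a) , + (x * b + y * a))
ι*pair x y a b = sym (cong₂ _,_ (ℤ.pos-* x a) second-coordinate)
  where
  second-coordinate : + (x * b + y * a) ≡ + x ℤ.* + b ℤ.+ + y ℤ.* + a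
  second-coordinate = trans (ℤ.pos-+ (x * b) (y * a)) (cong₂ ℤ._+_ (ℤ.pos-* x b) (ℤ.pos-* y a))

ΣR-combination : ∀ {n} (x y a b : Fin n → ℕ) →
  ΣR (λ i → ι (x i , y i) *R pairs a b i) ≡ (+ x · a , + (x · b + y · a))
ΣR-combination {zero}  x y a b = refl
ΣR-combination {suc n} x y a b = begin
    (ι (x₀ , y₀) *R pairs a b fz) +R ΣR (λ i → ι (x (fs i) , y (fs i)) *R pairs a b (fs i))
  ≡⟨ cong₂ _+R_ (ι*pair x₀ y₀ (a fz) (b fz)) (ΣR-combination (tail x) (tail y) (tail a) (tail b)) ⟩
    (+ (x₀ * a fz + tail x · tail a) ,
     + (x₀ * b fz + y₀ * a fz + (tail x · tail b + tail y · tail a)))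
  ≡⟨ cong (λ s → (+ (x₀ * a fz + tail x · tail a) , + s))
          (+-interchange (x₀ * b fz) (y₀ * a fz) (tail x · tail b) (tail y · tail a)) ⟩
    (+ x · a , + (x · b + y · a))
  ∎
  where
  open ≡-Reasoning
  x₀ = x fz
  y₀ = y fz
  tail : (Fin (suc n) → ℕ) → Fin n → ℕ
  tail f i = f (fs i)

∈MN-pairs⇒ : ∀ {n} {a b : Fin n → ℕ} {w : R} → w ∈MN pairs a b →
  ∃₂ λ x y → w ≡ (+ x · a , + (x · b + y · a))
∈MN-pairs⇒ {a = a} {b} (lam , eq) =
  x , y , trans (sym eq) (ΣR-combination x y a b)
  where
  x = λ i → proj₁ (lam i)
  y = λ i → proj₂ (lam i)

NatBézout : ∀ {n} → (Fin n → ℕ) → ℕ → Set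
NatBézout f d = ∃₂ λ p q → p · f ≡ d + q · f

gcdFin-bézout : ∀ {n} (f : Fin n → ℕ) → NatBézout f (gcdFin f)
gcdFin-bézout {zero}  f = (λ _ → 0) , (λ _ → 0) , refl
gcdFin-bézout {suc n} f
  with gcdFin-bézout f′ | Bézout.identity (gcd-GCD (f fz) (gcdFin f′))
  where f′ = λ i → f (fs i)
... | p , q , p·f′≡g′+q·f′ | Bézout.+- x y g+y*g′≡x*f₀ =
  (x ∷ λ i → y * q i) , (0 ∷ λ i → y * p i) , (begin
    x * f fz + (λ i → y * q i) · f′    ≡⟨ cong₂ _+_ (sym g+y*g′≡x*f₀) (·-scaleˡ y q f′) ⟩
    g + y * g′ + y * q · f′            ≡⟨ +-assoc g _ _ ⟩
    g + (y * g′ + y * q · f′)          ≡⟨ cong (_+_ g) (sym (*-distribˡ-+ y g′ _)) ⟩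
    g + y * (g′ + q · f′)              ≡⟨ cong (λ s → g + y * s) (sym p·f′≡g′+q·f′) ⟩
    g + y * p · f′                     ≡⟨ cong (_+_ g) (sym (·-scaleˡ y p f′)) ⟩
    g + (0 + (λ i → y * p i) · f′)     ∎)
  where
  open ≡-Reasoning
  f′ = λ i → f (fs i)
  g′ = gcdFin f′
  g = gcd (f fz) g′
... | p , q , p·f′≡g′+q·f′ | Bézout.-+ x y g+x*f₀≡y*g′ =
  (0 ∷ λ i → y * p i) , (x ∷ λ i → y * q i) , (begin
    0 + (λ i → y * p i) · f′           ≡⟨ ·-scaleˡ y p f′ ⟩
    y * p · f′                         ≡⟨ cong (y *_) p·f′≡g′+q·f′ ⟩
    y * (g′ + q · f′)                  ≡⟨ *-distribˡ-+ y g′ _ ⟩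
    y * g′ + y * q · f′                ≡⟨ cong (_+ y * q · f′) (sym g+x*f₀≡y*g′) ⟩
    g + x * f fz + y * q · f′          ≡⟨ +-assoc g _ _ ⟩
    g + (x * f fz + y * q · f′)        ≡⟨ cong (λ s → g + (x * f fz + s)) (sym (·-scaleˡ y q f′)) ⟩
    g + (x * f fz + (λ i → y * q i) · f′) ∎)
  where
  open ≡-Reasoning
  f′ = λ i → f (fs i)
  g′ = gcdFin f′
  g = gcd (f fz) g′

BoundedRepresentations : ∀ {n} → (Fin n → ℕ) → (Fin n → ℕ) → ℕ → ℕ → Set
BoundedRepresentations a b M B = ∀ u → ∃ λ x → x · a ≡ M + u × x · b ≤ B

boundedRepresentations⇒∈Frob : ∀ {n} {a b : Fin n → ℕ} {M B : ℕ} →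
  BoundedRepresentations a b M B → ι (M , B + M) ∈Frob pairs a b
boundedRepresentations⇒∈Frob {a = a} {b} {M} {B} rep (u₁ , u₂) =
  (λ i → (x i , y i)) ,
  trans (ΣR-combination x y a b) (cong₂ _,_ (cong +_ x·a≡M+u₁) (cong +_ second-coordinate))
  where
  open ≡-Reasoning
  x = proj₁ (rep u₁)
  x·a≡M+u₁ = proj₁ (proj₂ (rep u₁))
  x·b≤B = proj₂ (proj₂ (rep u₁))
  y = proj₁ (rep (B ∸ x · b + u₂))
  y·a≡ = proj₁ (proj₂ (rep (B ∸ x · b + u₂)))
  regroup : ∀ xb M c u → xb + (M + (c + u)) ≡ c + xb + M + u
  regroup = solve-∀
  second-coordinate : x · b + y · a ≡ B + M + u₂
  second-coordinate = begin
    x · b + y · a                  ≡⟨ cong (_+_ (x · b)) y·a≡ ⟩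
    x · b + (M + (B ∸ x · b + u₂)) ≡⟨ regroup (x · b) M (B ∸ x · b) u₂ ⟩
    B ∸ x · b + x · b + M + u₂     ≡⟨ cong (λ s → s + M + u₂) (m∸n+n≡m x·b≤B) ⟩
    B + M + u₂                     ∎

bounded-representations : ∀ {n} (a b p q : Fin n → ℕ) (k : Fin n) .{{_ : NonZero (a k)}} →
  b k ≡ 0 → p · a ≡ 1 + q · a →
  BoundedRepresentations a b (a k * q · a) (a k * p · b + a k * q · b)
bounded-representations a b p q k bk≡0 p·a≡1+q·a u = x , x·a≡ , x·b≤
  where
  r = u % a k
  t = u / a k
  d = a k ∸ r
  r≤aₖ = m%n≤n u (a k)
  x = λ i → r * p i + d * q i + t * δ k i
  x·-expand : ∀ v → x · v ≡ r * p · v + d * q · v + t * v k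
  x·-expand v = begin
    x · v
      ≡⟨ ·-distribˡ-+ (λ i → r * p i + d * q i) (λ i → t * δ k i) v ⟩
    (λ i → r * p i + d * q i) · v + (λ i → t * δ k i) · v
      ≡⟨ cong₂ _+_ (·-distribˡ-+ (λ i → r * p i) (λ i → d * q i) v)
                   (trans (·-scaleˡ t (δ k) v) (cong (t *_) (δ-· k v))) ⟩
    (λ i → r * p i) · v + (λ i → d * q i) · v + t * v k
      ≡⟨ cong (λ s → s + t * v k) (cong₂ _+_ (·-scaleˡ r p v) (·-scaleˡ d q v)) ⟩
    r * p · v + d * q · v + t * v k
      ∎
    where open ≡-Reasoning
  regroup : ∀ r d t N m → r * (1 + N) + d * N + t * m ≡ (r + d) * N + (r + t * m)
  regroup = solve-∀
  x·a≡ : x · a ≡ a k * q · a + u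
  x·a≡ = begin
    x · a                                   ≡⟨ x·-expand a ⟩
    r * p · a + d * q · a + t * a k         ≡⟨ cong (λ s → r * s + d * q · a + t * a k) p·a≡1+q·a ⟩
    r * (1 + q · a) + d * q · a + t * a k   ≡⟨ regroup r d t (q · a) (a k) ⟩
    (r + d) * q · a + (r + t * a k)         ≡⟨ cong₂ (λ m s → m * q · a + s) (m+[n∸m]≡n r≤aₖ)
                                                       (sym (m≡m%n+[m/n]*n u (a k))) ⟩
    a k * q · a + u                         ∎
    where open ≡-Reasoning
  x·b≤ : x · b ≤ a k * p · b + a k * q · b
  x·b≤ = begin
    x · b                             ≡⟨ x·-expand b ⟩
    r * p · b + d * q · b + t * b k   ≡⟨ cong (_+_ (r * p · b + d * q · b)) (trans (cong (t *_) bk≡0) (*-zeroʳ t)) ⟩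
    r * p · b + d * q · b + 0         ≡⟨ +-identityʳ _ ⟩
    r * p · b + d * q · b             ≤⟨ +-mono-≤ (*-monoˡ-≤ (p · b) r≤aₖ) (*-monoˡ-≤ (q · b) (m∸n≤m (a k) r)) ⟩
    a k * p · b + a k * q · b         ∎
    where open ≤-Reasoning

b≡0⇒∃∈Frob : ∀ {n} (a b : Fin n → ℕ) (k : Fin n) → a k > 0 → b k ≡ 0 → gcdFin a ≡ 1 →
  ∃ λ w → w ∈Frob pairs a b
b≡0⇒∃∈Frob a b k aₖ>0 bk≡0 gcd≡1 with gcdFin-bézout a
... | p , q , p·a≡gcd+q·a = ι (M , B + M) , boundedRepresentations⇒∈Frob
        (bounded-representations a b p q k {{>-nonZero aₖ>0}} bk≡0
          (trans p·a≡gcd+q·a (cong (_+ q · a) gcd≡1)))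
  where
  M = a k * q · a
  B = a k * p · b + a k * q · b

shift-into-ℕ : ∀ (p : ℤ.ℤ) N → ∃₂ λ u m → p ℤ.+ + u ≡ + (m + N)
shift-into-ℕ (+ p)      N = N , p , refl
shift-into-ℕ ℤ.-[1+ p ] N = suc p + N , 0 , trans (ℤ.≤-⊖ (m≤m+n (suc p) N)) (cong +_ (m+n∸m≡n (suc p) N))

b-positive⇒∉Frob : ∀ {n} (a b : Fin n → ℕ) → (∀ i → b i > 0) → ∀ w → ¬ w ∈Frob pairs a b
b-positive⇒∉Frob a b b>0 (p , q) w∈Frob with shift-into-ℕ p (suc (sum a * ℤ.∣ q ∣))
... | u , m , p+u≡m+N with ∈MN-pairs⇒ (w∈Frob (u , 0))
... | x , y , eq = <-irrefl refl (begin-strict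
    S * ℤ.∣ q ∣          <⟨ n<1+n _ ⟩
    suc (S * ℤ.∣ q ∣)    ≤⟨ m≤n+m _ m ⟩
    m + suc (S * ℤ.∣ q ∣) ≡⟨ ℤ.+-injective (trans (sym p+u≡m+N) (cong proj₁ eq)) ⟩
    x · a                ≤⟨ ·-monoʳ-≤ x a≤Sb ⟩
    x · (λ i → S * b i)  ≡⟨ ·-scaleʳ S x b ⟩
    S * x · b            ≤⟨ *-monoʳ-≤ S (m≤m+n (x · b) (y · a)) ⟩
    S * (x · b + y · a)  ≡⟨ cong (λ z → S * ℤ.∣ z ∣) (trans (sym (cong proj₂ eq)) (ℤ.+-identityʳ q)) ⟩
    S * ℤ.∣ q ∣          ∎)
  where
  open ≤-Reasoning
  S = sum a
  a≤Sb : ∀ i → a i ≤ S * b i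
  a≤Sb i = ≤-trans (≤-sum a i) (m≤m*n S (b i) {{>-nonZero (b>0 i)}})

∈Frob⇒∃b≡0 : ∀ {n} (a b : Fin n → ℕ) → ∃ (λ w → w ∈Frob pairs a b) → ∃ λ i → b i ≡ 0
∈Frob⇒∃b≡0 a b (w , w∈Frob) with any? (λ i → b i ≟ 0)
... | yes b≡0 = b≡0
... | no ¬b≡0 = contradiction w∈Frob
  (b-positive⇒∉Frob a b (λ i → n≢0⇒n>0 (λ bᵢ≡0 → ¬b≡0 (i , bᵢ≡0))) w)

corollary4p1 : (n : ℕ) → n ≥ 2 → (a b : Fin n → ℕ) → (∀ i → a i > 0) →
    gcdFin a ≡ 1 →
    ((∃ λ (w : R) → w ∈Frob (λ i → (+ a i , + b i))) ⇔ (∃ λ (i : Fin n) → b i ≡ 0))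
corollary4p1 n _ a b a>0 gcd≡1 =
  mk⇔ (∈Frob⇒∃b≡0 a b) (λ (k , bk≡0) → b≡0⇒∃∈Frob a b k (a>0 k) bk≡0 gcd≡1)
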